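{- If there exist an antipodal $k_1$-splitting of $Q_2^{n_1}$ and an antipodal $k_2$-splitting of $Q_2^{n_2}$, then there exists an antipodal $k_1k_2$-splitting of $Q_2^{n_1n_2}$.
   Context: $Q_2^n=\{0,1\}^n$. An $m$-face of $Q_2^n$ is a tuple $a\in\{0,1,*\}^n$ with exactly $m$ entries $*$, identified with $\{x\in Q_2^n: x_i=a_i$ whenever $a_i\in\{0,1\}\}$. Faces are parallel if their sets of $*$-positions coincide; parallel faces $a,b$ are antipodal if $b_i=1-a_i$ whenever $a_i\ne*$. An antipodal $k$-splitting of $Q_2^n$ is a collection of exactly $2^k$ $(n-k)$-faces whose union is $Q_2^n$ and which contains no two distinct parallel non-antipodal faces. -}

module Defs where

open import Data.Nat using (ℕ; zero; suc; _+_; _^_)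
open import Data.Bool using (Bool; true; false; not)
open import Data.Vec using (Vec; []; _∷_; lookup)
open import Data.Fin using (Fin)
open import Data.List using (List; length)
open import Data.List.Membership.Propositional using (_∈_)
open import Data.List.Relation.Unary.Unique.Propositional using (Unique)
open import Data.Product using (_×_; ∃)
open import Relation.Binary.PropositionalEquality using (_≡_)
open import Relation.Nullary using (¬_)

Point : ℕ → Set
Point n = Vec Bool n

data Entry : Set where
  bit  : Bool → Entry
  star : Entry

-- A face of Q_2^n is a tuple in {0,1,*}^n.
Face : ℕ → Set
Face n = Vec Entry n

stars : ∀ {n} → Face n → ℕ
stars []           = 0
stars (bit _ ∷ a)  = stars a
stars (star ∷ a)   = suc (stars a)

_∈F_ : ∀ {n} → Point n → Face n → Set
x ∈F a = ∀ i (b : Bool) → lookup a i ≡ bit b → lookup x i ≡ b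

Parallel : ∀ {n} → Face n → Face n → Set
Parallel a b = ∀ i → (lookup a i ≡ star → lookup b i ≡ star) × (lookup b i ≡ star → lookup a i ≡ star)

Antipodal : ∀ {n} → Face n → Face n → Set
Antipodal a b = Parallel a b × (∀ i (c : Bool) → lookup a i ≡ bit c → lookup b i ≡ bit (not c))

record AntipodalSplitting (n k : ℕ) : Set where
  field
    faces     : List (Face n)
    distinct  : Unique faces
    card      : length faces ≡ 2 ^ k
    dim       : ∀ a → a ∈ faces → stars a + k ≡ n
    cover     : ∀ (x : Point n) → ∃ λ a → a ∈ faces × x ∈F a
    antipodal : ∀ a b → a ∈ faces → b ∈ faces → ¬ a ≡ b → Parallel a b → Antipodal a b

-- In an antipodal splitting two distinct parallel faces are antipodal, and a face has
-- only one antipode, so parallelism pairs up faces. Hence the 2^k₂ faces of the second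
-- splitting can be divided into two halves of 2^(k₂-1) faces, half c for c ∈ {0,1},
-- each free of parallel pairs, such that parallel faces from different halves are
-- antipodal. Now replace every coordinate of a face a of the first splitting by a
-- block of n₂ coordinates: a * by the all-* block, a bit c by any face of half c. This
-- gives 2^k₁ (2^(k₂-1))^k₁ = 2^(k₁k₂) faces of codimension k₁k₂. A point, cut into n₁
-- rows, lies in one of them: every row lies in a face of some half c, and the vector
-- of these c lies in a face of the first splitting. Parallel substituted faces come
-- from parallel faces a, a′, because no face of a half is parallel to the all-* block;
-- if a = a′ their blocks coincide, and otherwise a, a′ are antipodal and so are all
-- blocks. For k₂ = 0 the whole cube is the splitting.

module Submission where

open import Defs
open import Data.Nat using (ℕ; _*_)

open import Level using (Level; _⊔_)
open import Function using (_∘_; _⇔_; mk⇔; Equivalence)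
open import Data.Bool using (Bool; true; false; not)
open import Data.Bool.Properties using (not-¬) renaming (_≟_ to _≟ᵇ_)
open import Data.Empty using (⊥; ⊥-elim)
open import Data.Nat using (zero; suc; _+_; _^_; _<_; ⌊_/2⌋; ⌈_/2⌉)
open import Data.Nat.Properties
  using (+-identityʳ; +-suc; +-assoc; *-identityˡ; *-comm; *-zeroʳ; +-cancelˡ-≡; m+1+n≢m; ^-*-assoc;
         ^-distribˡ-+-*; n<1+n; m<n⇒m<1+n; n≡⌊n+n/2⌋; n≡⌈n+n/2⌉; +-commutativeSemigroup)
open import Algebra.Properties.CommutativeSemigroup +-commutativeSemigroup using (interchange)
open import Data.Nat.Induction using (<-wellFounded)
open import Induction.WellFounded using (Acc; acc)
open import Data.Product using (_×_; _,_; proj₁; proj₂; ∃; ∃₂)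
open import Data.Sum using (_⊎_; inj₁; inj₂)
open import Data.List using (List; []; _∷_; [_]; _++_; length; map; concatMap; cartesianProductWith)
open import Data.List.Properties using (length-++; length-map)
open import Data.List.Relation.Unary.Any using (here; there; any?)
open import Data.List.Relation.Unary.All as All using (All; []; _∷_)
import Data.List.Relation.Unary.All.Properties as Allₚ
open import Data.List.Relation.Unary.AllPairs as AllPairs using (AllPairs; []; _∷_)
import Data.List.Relation.Unary.AllPairs.Properties as AllPairsₚ
open import Data.List.Relation.Unary.Unique.Propositional using (Unique)
import Data.List.Relation.Unary.Unique.Propositional.Properties as Uniqueₚ
open import Data.List.Relation.Binary.Disjoint.Propositional using (Disjoint)
open import Data.List.Relation.Binary.Subset.Propositional using (_⊆_)
open import Data.List.Membership.Propositional using (_∈_; _∉_; find; lose)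
open import Data.List.Membership.Propositional.Properties
  using (∈-++⁺ˡ; ∈-++⁺ʳ; ∈-++⁻; ∈-map⁺; ∈-map⁻; ∈-concatMap⁺; ∈-concatMap⁻;
         ∈-cartesianProductWith⁺; ∈-cartesianProductWith⁻; ∈-∃++)
open import Data.List.Relation.Binary.Permutation.Propositional
  using (_↭_; ↭-refl; ↭-prep; ↭-sym; ↭-trans; ↭⇒↭ₛ)
open import Data.List.Relation.Binary.Permutation.Propositional.Properties
  using (∈-resp-↭; ↭-length; shift; ++-comm)
import Data.List.Relation.Binary.Permutation.Setoid.Properties as Permutationₛ
open import Data.Vec using (Vec; []; _∷_; lookup; replicate; concat; group) renaming (map to vmap; _++_ to _++ᵛ_)
open import Data.Vec.Properties using (∷-injective; ≡-dec)
open import Data.Vec.Relation.Unary.All as VecAll using () renaming (All to VecAll)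
import Data.Vec.Relation.Unary.All.Properties as VecAllₚ
open import Data.Vec.Relation.Binary.Pointwise.Inductive as Pointwise
  using (Pointwise; []; _∷_; Pointwise-≡⇒≡; ≡⇒Pointwise-≡)
open import Data.Vec.Relation.Binary.Pointwise.Extensional using (ext; extensional⇒inductive)
open import Relation.Binary using (REL; Rel; Reflexive; Symmetric; Decidable; DecidableEquality)
open import Relation.Binary.PropositionalEquality
  using (_≡_; _≢_; refl; sym; trans; cong; cong₂; subst; setoid; module ≡-Reasoning)
open import Relation.Nullary using (¬_; yes; no; map′)

private
  variable
    a b ℓ ℓ′ : Level
    A : Set a
    B : Set b
    m n k : ℕ
    x y : A
    xs ys : List A

⌊2*n/2⌋≡n : ∀ n → ⌊ 2 * n /2⌋ ≡ n
⌊2*n/2⌋≡n n = sym (trans (n≡⌊n+n/2⌋ n) (cong (λ m → ⌊ n + m /2⌋) (sym (+-identityʳ n))))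

⌈2*n/2⌉≡n : ∀ n → ⌈ 2 * n /2⌉ ≡ n
⌈2*n/2⌉≡n n = sym (trans (n≡⌈n+n/2⌉ n) (cong (λ m → ⌈ n + m /2⌉) (sym (+-identityʳ n))))

allChoices : Vec (List A) m → List (Vec A m)
allChoices []         = [ [] ]
allChoices (xs ∷ xss) = cartesianProductWith _∷_ xs (allChoices xss)

∈-allChoices⁺ : ∀ {xss : Vec (List A) m} {zs} → Pointwise _∈_ zs xss → zs ∈ allChoices xss
∈-allChoices⁺ []              = here refl
∈-allChoices⁺ (z∈xs ∷ zs∈xss) = ∈-cartesianProductWith⁺ _∷_ z∈xs (∈-allChoices⁺ zs∈xss)

∈-allChoices⁻ : ∀ (xss : Vec (List A) m) {zs} → zs ∈ allChoices xss → Pointwise _∈_ zs xss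
∈-allChoices⁻ []         {[]} _ = []
∈-allChoices⁻ (xs ∷ xss) zs∈
  with _ , _ , z∈xs , zs′∈ , refl ← ∈-cartesianProductWith⁻ _∷_ xs (allChoices xss) zs∈
  = z∈xs ∷ ∈-allChoices⁻ xss zs′∈

Unique-allChoices : ∀ {xss : Vec (List A) m} → VecAll Unique xss → Unique (allChoices xss)
Unique-allChoices VecAll.[]         = [] ∷ []
Unique-allChoices (u VecAll.∷ us) =
  Uniqueₚ.cartesianProductWith⁺ _∷_ ∷-injective u (Unique-allChoices us)

length-cartesianProductWith : ∀ {C : Set a} (f : A → B → C) xs ys →
                              length (cartesianProductWith f xs ys) ≡ length xs * length ys
length-cartesianProductWith f []       ys = refl
length-cartesianProductWith f (x ∷ xs) ys = begin
  length (map (f x) ys ++ cartesianProductWith f xs ys)          ≡⟨ length-++ (map (f x) ys) ⟩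
  length (map (f x) ys) + length (cartesianProductWith f xs ys)  ≡⟨ cong₂ _+_ (length-map (f x) ys)
                                                                      (length-cartesianProductWith f xs ys) ⟩
  length ys + length xs * length ys                               ∎
  where open ≡-Reasoning

length-concatMap : ∀ (f : A → List B) {c} xs → All (λ x → length (f x) ≡ c) xs →
                   length (concatMap f xs) ≡ length xs * c
length-concatMap f []       []           = refl
length-concatMap f (x ∷ xs) (fx≡c ∷ fxs) =
  trans (length-++ (f x)) (cong₂ _+_ fx≡c (length-concatMap f xs fxs))

Unique-concatMap : ∀ (f : A → List B) → Unique xs → (∀ x → Unique (f x)) →
                   (∀ {x x′ y} → y ∈ f x → y ∈ f x′ → x ≡ x′) → Unique (concatMap f xs)
Unique-concatMap f uniq f-unique f-disjoint = Uniqueₚ.concat⁺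
  (Allₚ.map⁺ (All.universal f-unique _))
  (AllPairsₚ.map⁺ (AllPairs.map (λ x≢x′ {_} (y∈ , y∈′) → x≢x′ (f-disjoint y∈ y∈′)) uniq))

Unique-++⇒Disjoint : ∀ (xs : List A) → Unique (xs ++ ys) → Disjoint xs ys
Unique-++⇒Disjoint (x ∷ xs) (x∉ ∷ _)    (here refl , x∈ys) = All.lookup x∉ (∈-++⁺ʳ xs x∈ys) refl
Unique-++⇒Disjoint (x ∷ xs) (_  ∷ uniq) (there y∈xs , y∈ys) = Unique-++⇒Disjoint xs uniq (y∈xs , y∈ys)

Unique-resp-↭ : ∀ {A : Set a} {xs ys : List A} → xs ↭ ys → Unique xs → Unique ys
Unique-resp-↭ {A = A} σ = Permutationₛ.Unique-resp-↭ (setoid A) (↭⇒↭ₛ σ)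

∈-∃↭ : x ∈ xs → ∃ λ ys → xs ↭ x ∷ ys
∈-∃↭ x∈xs with ys , zs , refl ← ∈-∃++ x∈xs = ys ++ zs , shift _ ys zs

concat-injective : ∀ {xss yss : Vec (Vec A m) n} → concat xss ≡ concat yss → xss ≡ yss
concat-injective {xss = xss} {yss} eq =
  Pointwise-≡⇒≡ (Pointwise.map Pointwise-≡⇒≡ (Pointwise.concat⁻ xss yss (≡⇒Pointwise-≡ eq)))

Pointwise⇔lookup : ∀ {R : REL A B ℓ} {S : REL A B ℓ′} → (∀ {x y} → R x y ⇔ S x y) →
                   ∀ {xs : Vec A n} {ys} → Pointwise R xs ys ⇔ (∀ i → S (lookup xs i) (lookup ys i))
Pointwise⇔lookup R⇔S = mk⇔
  (λ rs i → Equivalence.to R⇔S (Pointwise.lookup rs i))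
  (λ ss → extensional⇒inductive (ext (λ i → Equivalence.from R⇔S (ss i))))

-- Balanced bisections

Independent : Rel A ℓ → List A → Set _
Independent _∼_ = AllPairs (λ x y → ¬ x ∼ y)

AtMostOnePartner : Rel A ℓ → List A → Set _
AtMostOnePartner _∼_ xs =
  ∀ {x y z} → x ∈ xs → y ∈ xs → z ∈ xs → x ≢ y → x ≢ z → x ∼ y → x ∼ z → y ≡ z

record Bisection {A : Set a} (_∼_ : Rel A ℓ) (xs : List A) : Set (a ⊔ ℓ) where
  field
    left right        : List A
    partition         : left ++ right ↭ xs
    left-independent  : Independent _∼_ left
    right-independent : Independent _∼_ right
    left-length       : length left  ≡ ⌈ length xs /2⌉
    right-length      : length right ≡ ⌊ length xs /2⌋

  left-⊆ : left ⊆ xs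
  left-⊆ x∈ = ∈-resp-↭ partition (∈-++⁺ˡ x∈)

  right-⊆ : right ⊆ xs
  right-⊆ x∈ = ∈-resp-↭ partition (∈-++⁺ʳ left x∈)

  ∈-left⊎right : ∀ {x} → x ∈ xs → x ∈ left ⊎ x ∈ right
  ∈-left⊎right x∈ = ∈-++⁻ left (∈-resp-↭ (↭-sym partition) x∈)

module _ {A : Set a} {_∼_ : Rel A ℓ} where

  Independent⇒Unique : Reflexive _∼_ → Independent _∼_ xs → Unique xs
  Independent⇒Unique ∼-refl = AllPairs.map (λ { x≁y refl → x≁y ∼-refl })

  Independent-∼⇒≡ : Symmetric _∼_ → Independent _∼_ xs → x ∈ xs → y ∈ xs → x ∼ y → x ≡ y
  Independent-∼⇒≡ ∼-sym (_   ∷ _)   (here refl) (here refl) _   = refl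
  Independent-∼⇒≡ ∼-sym (x≁ ∷ _)   (here refl) (there y∈)  x∼y = ⊥-elim (All.lookup x≁ y∈ x∼y)
  Independent-∼⇒≡ ∼-sym (y≁ ∷ _)   (there x∈)  (here refl) x∼y = ⊥-elim (All.lookup y≁ x∈ (∼-sym x∼y))
  Independent-∼⇒≡ ∼-sym (_   ∷ ind) (there x∈)  (there y∈)  x∼y = Independent-∼⇒≡ ∼-sym ind x∈ y∈ x∼y

  AtMostOnePartner-⊆ : ys ⊆ xs → AtMostOnePartner _∼_ xs → AtMostOnePartner _∼_ ys
  AtMostOnePartner-⊆ ys⊆xs partner x∈ y∈ z∈ = partner (ys⊆xs x∈) (ys⊆xs y∈) (ys⊆xs z∈)

  Bisection-resp-↭ : xs ↭ ys → Bisection _∼_ xs → Bisection _∼_ ys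
  Bisection-resp-↭ σ h = record
    { left              = left
    ; right             = right
    ; partition         = ↭-trans partition σ
    ; left-independent  = left-independent
    ; right-independent = right-independent
    ; left-length       = trans left-length (cong ⌈_/2⌉ (↭-length σ))
    ; right-length      = trans right-length (cong ⌊_/2⌋ (↭-length σ))
    }
    where open Bisection h

  bisection-[] : Bisection _∼_ []
  bisection-[] = record
    { left = [] ; right = [] ; partition = ↭-refl
    ; left-independent = [] ; right-independent = []
    ; left-length = refl ; right-length = refl }

  -- The new element goes to the shorter half, which then becomes the left one.
  bisection-∷ : (∀ {z} → z ∈ xs → ¬ x ∼ z) → Bisection _∼_ xs → Bisection _∼_ (x ∷ xs)
  bisection-∷ {x = x} x≁xs h = record
    { left              = x ∷ right
    ; right             = left
    ; partition         = ↭-prep x (↭-trans (++-comm right left) partition)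
    ; left-independent  = All.tabulate (λ z∈ → x≁xs (right-⊆ z∈)) ∷ right-independent
    ; right-independent = left-independent
    ; left-length       = cong suc right-length
    ; right-length      = left-length
    }
    where open Bisection h

  bisection-∷∷ : (∀ {z} → z ∈ xs → ¬ x ∼ z) → (∀ {z} → z ∈ xs → ¬ y ∼ z) →
                 Bisection _∼_ xs → Bisection _∼_ (x ∷ y ∷ xs)
  bisection-∷∷ {x = x} {y = y} x≁xs y≁xs h = record
    { left              = x ∷ left
    ; right             = y ∷ right
    ; partition         = ↭-prep x (↭-trans (shift y left right) (↭-prep y partition))
    ; left-independent  = All.tabulate (λ z∈ → x≁xs (left-⊆ z∈)) ∷ left-independent
    ; right-independent = All.tabulate (λ z∈ → y≁xs (right-⊆ z∈)) ∷ right-independent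
    ; left-length       = cong suc left-length
    ; right-length      = cong suc right-length
    }
    where open Bisection h

  partners-unrelated : Symmetric _∼_ → Unique (x ∷ y ∷ ys) → AtMostOnePartner _∼_ (x ∷ y ∷ ys) →
                       x ∼ y → (∀ {z} → z ∈ ys → ¬ x ∼ z) × (∀ {z} → z ∈ ys → ¬ y ∼ z)
  partners-unrelated ∼-sym ((x≢y ∷ x∉ys) ∷ y∉ys ∷ _) partner x∼y =
      (λ z∈ x∼z → All.lookup y∉ys z∈ (partner (here refl) (there (here refl)) (there (there z∈))
                                        x≢y (All.lookup x∉ys z∈) x∼y x∼z))
    , (λ z∈ y∼z → All.lookup x∉ys z∈ (partner (there (here refl)) (here refl) (there (there z∈))
                                        (x≢y ∘ sym) (All.lookup y∉ys z∈) (∼-sym x∼y) y∼z))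

  bisection : Symmetric _∼_ → Decidable _∼_ → Unique xs → AtMostOnePartner _∼_ xs → Bisection _∼_ xs
  bisection ∼-sym _∼?_ = go _ (<-wellFounded _)
    where
    go : ∀ xs → Acc _<_ (length xs) → Unique xs → AtMostOnePartner _∼_ xs → Bisection _∼_ xs
    go-pair : Unique (x ∷ y ∷ ys) → AtMostOnePartner _∼_ (x ∷ y ∷ ys) → x ∼ y →
              Acc _<_ (length ys) → Bisection _∼_ (x ∷ y ∷ ys)

    go []       _         _                 _       = bisection-[]
    go (x ∷ xs) (acc rec) uniq@(_ ∷ uniq′) partner with any? (x ∼?_) xs
    ... | no x≁xs = bisection-∷ (λ z∈ x∼z → x≁xs (lose z∈ x∼z))
                      (go xs (rec (n<1+n _)) uniq′ (AtMostOnePartner-⊆ there partner))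
    ... | yes x∼xs with y , y∈xs , x∼y ← find x∼xs with ys , σ ← ∈-∃↭ y∈xs =
      let τ = ↭-prep x σ in
      Bisection-resp-↭ (↭-sym τ)
        (go-pair (Unique-resp-↭ τ uniq) (AtMostOnePartner-⊆ (∈-resp-↭ (↭-sym τ)) partner) x∼y
                 (rec (subst (length ys <_) (sym (↭-length τ)) (m<n⇒m<1+n (n<1+n _)))))

    go-pair uniq@(_ ∷ _ ∷ uniq′) partner x∼y acc-ys =
      let x≁ys , y≁ys = partners-unrelated ∼-sym uniq partner x∼y
      in bisection-∷∷ x≁ys y≁ys (go _ acc-ys uniq′ (AtMostOnePartner-⊆ (there ∘ there) partner))

-- Faces as pointwise relations

data _∈ᵉ_ : Bool → Entry → Set where
  ∈-star : ∀ {x} → x ∈ᵉ star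
  ∈-bit  : ∀ {x} → x ∈ᵉ bit x

data _∥ᵉ_ : Entry → Entry → Set where
  ∥-star : star ∥ᵉ star
  ∥-bit  : ∀ {b c} → bit b ∥ᵉ bit c

data _⇋ᵉ_ : Entry → Entry → Set where
  ⇋-star : star ⇋ᵉ star
  ⇋-bit  : ∀ {b} → bit b ⇋ᵉ bit (not b)

_∈ᶠ_ : Point n → Face n → Set
_∈ᶠ_ = Pointwise _∈ᵉ_

_∥ᶠ_ : Face n → Face n → Set
_∥ᶠ_ = Pointwise _∥ᵉ_

_⇋ᶠ_ : Face n → Face n → Set
_⇋ᶠ_ = Pointwise _⇋ᵉ_

∈ᵉ⇔ : ∀ {x e} → x ∈ᵉ e ⇔ (∀ b → e ≡ bit b → x ≡ b)
∈ᵉ⇔ = mk⇔ to from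
  where
  to : ∀ {x e} → x ∈ᵉ e → ∀ b → e ≡ bit b → x ≡ b
  to ∈-bit _ refl = refl
  from : ∀ {x e} → (∀ b → e ≡ bit b → x ≡ b) → x ∈ᵉ e
  from {e = star}  _ = ∈-star
  from {e = bit b} h with refl ← h b refl = ∈-bit

∥ᵉ⇔ : ∀ {e e′} → e ∥ᵉ e′ ⇔ ((e ≡ star → e′ ≡ star) × (e′ ≡ star → e ≡ star))
∥ᵉ⇔ = mk⇔ to from
  where
  to : ∀ {e e′} → e ∥ᵉ e′ → (e ≡ star → e′ ≡ star) × (e′ ≡ star → e ≡ star)
  to ∥-star = (λ _ → refl) , (λ _ → refl)
  to ∥-bit  = (λ ()) , (λ ())
  from : ∀ {e e′} → (e ≡ star → e′ ≡ star) × (e′ ≡ star → e ≡ star) → e ∥ᵉ e′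
  from {star}  {star}  _ = ∥-star
  from {bit _} {bit _} _ = ∥-bit
  from {star}  {bit _} (h , _) with () ← h refl
  from {bit _} {star}  (_ , h) with () ← h refl

⇋ᵉ⇔ : ∀ {e e′} → e ⇋ᵉ e′ ⇔ (e ∥ᵉ e′ × (∀ c → e ≡ bit c → e′ ≡ bit (not c)))
⇋ᵉ⇔ = mk⇔ to from
  where
  to : ∀ {e e′} → e ⇋ᵉ e′ → e ∥ᵉ e′ × (∀ c → e ≡ bit c → e′ ≡ bit (not c))
  to ⇋-star = ∥-star , λ _ ()
  to ⇋-bit  = ∥-bit , λ { _ refl → refl }
  from : ∀ {e e′} → e ∥ᵉ e′ × (∀ c → e ≡ bit c → e′ ≡ bit (not c)) → e ⇋ᵉ e′
  from (∥-star , _) = ⇋-star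
  from (∥-bit {b} , h) with refl ← h b refl = ⇋-bit

∈ᶠ⇔∈F : ∀ {x : Point n} {a} → x ∈ᶠ a ⇔ x ∈F a
∈ᶠ⇔∈F = Pointwise⇔lookup ∈ᵉ⇔

∥ᶠ⇔Parallel : ∀ {a b : Face n} → a ∥ᶠ b ⇔ Parallel a b
∥ᶠ⇔Parallel = Pointwise⇔lookup ∥ᵉ⇔

⇋ᶠ⇔Antipodal : ∀ {a b : Face n} → a ⇋ᶠ b ⇔ Antipodal a b
⇋ᶠ⇔Antipodal = mk⇔
  (λ a⇋b → let h = Equivalence.to (Pointwise⇔lookup ⇋ᵉ⇔) a⇋b
           in (λ i → Equivalence.to ∥ᵉ⇔ (proj₁ (h i))) , (λ i → proj₂ (h i)))
  (λ (a∥b , opposite) → Equivalence.from (Pointwise⇔lookup ⇋ᵉ⇔)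
     (λ i → Equivalence.from ∥ᵉ⇔ (a∥b i) , opposite i))

∥ᵉ-refl : Reflexive _∥ᵉ_
∥ᵉ-refl {star}  = ∥-star
∥ᵉ-refl {bit _} = ∥-bit

∥ᵉ-sym : Symmetric _∥ᵉ_
∥ᵉ-sym ∥-star = ∥-star
∥ᵉ-sym ∥-bit  = ∥-bit

_∥ᵉ?_ : Decidable _∥ᵉ_
star  ∥ᵉ? star  = yes ∥-star
bit _ ∥ᵉ? bit _ = yes ∥-bit
star  ∥ᵉ? bit _ = no λ ()
bit _ ∥ᵉ? star  = no λ ()

⇋ᵉ-functional : ∀ {e e′ e″} → e ⇋ᵉ e′ → e ⇋ᵉ e″ → e′ ≡ e″
⇋ᵉ-functional ⇋-star ⇋-star = refl
⇋ᵉ-functional ⇋-bit  ⇋-bit  = refl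

⇋ᵉ-self : ∀ {e e′} → e ⇋ᵉ e′ → e ≡ e′ → e ≡ star
⇋ᵉ-self ⇋-star     _  = refl
⇋ᵉ-self (⇋-bit {b}) eq = ⊥-elim (not-¬ refl (cong (λ { (bit c) → c ; star → b }) eq))

_≟ᵉ_ : DecidableEquality Entry
star  ≟ᵉ star  = yes refl
bit b ≟ᵉ bit c = map′ (cong bit) (λ { refl → refl }) (b ≟ᵇ c)
star  ≟ᵉ bit _ = no λ ()
bit _ ≟ᵉ star  = no λ ()

∥ᶠ-refl : Reflexive (_∥ᶠ_ {n})
∥ᶠ-refl = Pointwise.refl ∥ᵉ-refl

∥ᶠ-sym : Symmetric (_∥ᶠ_ {n})
∥ᶠ-sym = Pointwise.sym ∥ᵉ-sym

_∥ᶠ?_ : Decidable (_∥ᶠ_ {n})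
_∥ᶠ?_ = Pointwise.decidable _∥ᵉ?_

_≟ᶠ_ : DecidableEquality (Face n)
_≟ᶠ_ = ≡-dec _≟ᵉ_

⇋ᶠ-functional : ∀ {a b c : Face n} → a ⇋ᶠ b → a ⇋ᶠ c → b ≡ c
⇋ᶠ-functional []       []       = refl
⇋ᶠ-functional (p ∷ ps) (q ∷ qs) = cong₂ _∷_ (⇋ᵉ-functional p q) (⇋ᶠ-functional ps qs)

allStars : ∀ n → Face n
allStars n = replicate n star

⇋ᶠ-self : ∀ {a : Face n} → a ⇋ᶠ a → a ≡ allStars n
⇋ᶠ-self []       = refl
⇋ᶠ-self (p ∷ ps) = cong₂ _∷_ (⇋ᵉ-self p refl) (⇋ᶠ-self ps)

allStars-∥ᶠ : ∀ {b : Face n} → allStars n ∥ᶠ b → b ≡ allStars n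
allStars-∥ᶠ []           = refl
allStars-∥ᶠ (∥-star ∷ p) = cong (star ∷_) (allStars-∥ᶠ p)

⇋ᶠ-allStars : ∀ n → allStars n ⇋ᶠ allStars n
⇋ᶠ-allStars zero    = []
⇋ᶠ-allStars (suc n) = ⇋-star ∷ ⇋ᶠ-allStars n

∈ᶠ-allStars : ∀ (x : Point n) → x ∈ᶠ allStars n
∈ᶠ-allStars []      = []
∈ᶠ-allStars (_ ∷ x) = ∈-star ∷ ∈ᶠ-allStars x

stars-allStars : ∀ n → stars (allStars n) ≡ n
stars-allStars zero    = refl
stars-allStars (suc n) = cong suc (stars-allStars n)

stars-++ : ∀ (a : Face m) (b : Face n) → stars (a ++ᵛ b) ≡ stars a + stars b
stars-++ []          b = refl
stars-++ (bit _ ∷ a) b = stars-++ a b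
stars-++ (star ∷ a)  b = cong suc (stars-++ a b)

codim : Face n → ℕ
codim []          = 0
codim (bit _ ∷ a) = suc (codim a)
codim (star ∷ a)  = codim a

stars+codim : ∀ (a : Face n) → stars a + codim a ≡ n
stars+codim []          = refl
stars+codim (bit _ ∷ a) = trans (+-suc (stars a) (codim a)) (cong suc (stars+codim a))
stars+codim (star ∷ a)  = cong suc (stars+codim a)

module _ (S : AntipodalSplitting n k) where
  open AntipodalSplitting S

  coverᶠ : ∀ x → ∃ λ a → a ∈ faces × x ∈ᶠ a
  coverᶠ x with a , a∈ , x∈a ← cover x = a , a∈ , Equivalence.from ∈ᶠ⇔∈F x∈a

  antipodalᶠ : ∀ {a b} → a ∈ faces → b ∈ faces → a ≢ b → a ∥ᶠ b → a ⇋ᶠ b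
  antipodalᶠ a∈ b∈ a≢b a∥b = Equivalence.from ⇋ᶠ⇔Antipodal
    (antipodal _ _ a∈ b∈ a≢b (Equivalence.to ∥ᶠ⇔Parallel a∥b))

  at-most-one-antipode : AtMostOnePartner _∥ᶠ_ faces
  at-most-one-antipode x∈ y∈ z∈ x≢y x≢z x∥y x∥z =
    ⇋ᶠ-functional (antipodalᶠ x∈ y∈ x≢y x∥y) (antipodalᶠ x∈ z∈ x≢z x∥z)

wholeCube : ∀ n → AntipodalSplitting n 0
wholeCube n = record
  { faces     = [ allStars n ]
  ; distinct  = [] ∷ []
  ; card      = refl
  ; dim       = λ { _ (here refl) → trans (+-identityʳ _) (stars-allStars n) }
  ; cover     = λ x → allStars n , here refl , Equivalence.to ∈ᶠ⇔∈F (∈ᶠ-allStars x)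
  ; antipodal = λ { _ _ (here refl) (here refl) a≢b _ → ⊥-elim (a≢b refl) }
  }

record HalvedSplitting (n k : ℕ) : Set where
  field
    half          : Bool → List (Face n)
    distinct      : ∀ c → Unique (half c)
    card          : ∀ c → length (half c) ≡ 2 ^ k
    dim           : ∀ c {a} → a ∈ half c → stars a + suc k ≡ n
    cover         : ∀ x → ∃₂ λ c a → a ∈ half c × x ∈ᶠ a
    parallel-free : ∀ c {a b} → a ∈ half c → b ∈ half c → a ∥ᶠ b → a ≡ b
    antipodal     : ∀ c {a b} → a ∈ half c → b ∈ half (not c) → a ∥ᶠ b → a ⇋ᶠ b

halve : AntipodalSplitting n (suc k) → HalvedSplitting n k
halve {n} {k} S = record
  { half          = half
  ; distinct      = λ c → Independent⇒Unique ∥ᶠ-refl (half-independent c)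
  ; card          = half-length
  ; dim           = λ c a∈ → dim _ (half-⊆ c a∈)
  ; cover         = half-cover
  ; parallel-free = λ c → Independent-∼⇒≡ ∥ᶠ-sym (half-independent c)
  ; antipodal     = λ c a∈ b∈ → antipodalᶠ S (half-⊆ c a∈) (half-⊆ (not c) b∈)
                                  (λ { refl → halves-disjoint c a∈ b∈ })
  }
  where
  open AntipodalSplitting S
  open Bisection (bisection ∥ᶠ-sym _∥ᶠ?_ distinct (at-most-one-antipode S))

  half : Bool → List (Face n)
  half false = left
  half true  = right

  half-⊆ : ∀ c → half c ⊆ faces
  half-⊆ false = left-⊆
  half-⊆ true  = right-⊆

  half-independent : ∀ c → Independent _∥ᶠ_ (half c)
  half-independent false = left-independent
  half-independent true  = right-independent

  half-length : ∀ c → length (half c) ≡ 2 ^ k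
  half-length false = trans left-length  (trans (cong ⌈_/2⌉ card) (⌈2*n/2⌉≡n (2 ^ k)))
  half-length true  = trans right-length (trans (cong ⌊_/2⌋ card) (⌊2*n/2⌋≡n (2 ^ k)))

  half-cover : ∀ x → ∃₂ λ c a → a ∈ half c × x ∈ᶠ a
  half-cover x with a , a∈ , x∈a ← coverᶠ S x with ∈-left⊎right a∈
  ... | inj₁ a∈left  = false , a , a∈left  , x∈a
  ... | inj₂ a∈right = true  , a , a∈right , x∈a

  left-right-disjoint : Disjoint left right
  left-right-disjoint = Unique-++⇒Disjoint left (Unique-resp-↭ (↭-sym partition) distinct)

  halves-disjoint : ∀ c {a} → a ∈ half c → a ∈ half (not c) → ⊥
  halves-disjoint false a∈l a∈r = left-right-disjoint (a∈l , a∈r)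
  halves-disjoint true  a∈r a∈l = left-right-disjoint (a∈l , a∈r)

-- Substituting blocks for the entries of a face

module Substitution (H : HalvedSplitting n k) where
  open HalvedSplitting H

  blocks : Entry → List (Face n)
  blocks star    = [ allStars n ]
  blocks (bit c) = half c

  _fills_ : Vec (Face n) m → Face m → Set
  bs fills a = Pointwise _∈_ bs (vmap blocks a)

  substitutions : Face m → List (Vec (Face n) m)
  substitutions a = allChoices (vmap blocks a)

  allStars∉half : ∀ c → allStars n ∉ half c
  allStars∉half c a∈ = m+1+n≢m n (trans (cong (_+ suc k) (sym (stars-allStars n))) (dim c a∈))

  halves-disjoint : ∀ c {b} → b ∈ half c → b ∈ half (not c) → ⊥
  halves-disjoint c b∈ b∈′ =
    allStars∉half c (subst (_∈ half c) (⇋ᶠ-self (antipodal c b∈ b∈′ ∥ᶠ-refl)) b∈)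

  half-colour : ∀ c c′ {b} → b ∈ half c → b ∈ half c′ → c ≡ c′
  half-colour false false _  _   = refl
  half-colour true  true  _  _   = refl
  half-colour false true  b∈ b∈′ = ⊥-elim (halves-disjoint false b∈ b∈′)
  half-colour true  false b∈ b∈′ = ⊥-elim (halves-disjoint true b∈ b∈′)

  blocks-injective : ∀ e e′ {b} → b ∈ blocks e → b ∈ blocks e′ → e ≡ e′
  blocks-injective star    star     _           _           = refl
  blocks-injective (bit c) (bit c′) b∈          b∈′         = cong bit (half-colour c c′ b∈ b∈′)
  blocks-injective star    (bit c′) (here refl) b∈′         = ⊥-elim (allStars∉half c′ b∈′)
  blocks-injective (bit c) star     b∈          (here refl) = ⊥-elim (allStars∉half c b∈)

  blocks-parallel : ∀ e e′ {b b′} → b ∈ blocks e → b′ ∈ blocks e′ → b ∥ᶠ b′ → e ∥ᵉ e′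
  blocks-parallel star    star     _           _           _   = ∥-star
  blocks-parallel (bit _) (bit _)  _           _           _   = ∥-bit
  blocks-parallel star    (bit c′) (here refl) b′∈         b∥b′ =
    ⊥-elim (allStars∉half c′ (subst (_∈ half c′) (allStars-∥ᶠ b∥b′) b′∈))
  blocks-parallel (bit c) star     b∈          (here refl) b∥b′ =
    ⊥-elim (allStars∉half c (subst (_∈ half c) (allStars-∥ᶠ (∥ᶠ-sym b∥b′)) b∈))

  blocks-parallel-free : ∀ e {b b′} → b ∈ blocks e → b′ ∈ blocks e → b ∥ᶠ b′ → b ≡ b′
  blocks-parallel-free star    (here refl) (here refl) _ = refl
  blocks-parallel-free (bit c) b∈          b′∈         b∥b′ = parallel-free c b∈ b′∈ b∥b′

  blocks-antipodal : ∀ {e e′ b b′} → e ⇋ᵉ e′ → b ∈ blocks e → b′ ∈ blocks e′ → b ∥ᶠ b′ → b ⇋ᶠ b′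
  blocks-antipodal ⇋-star      (here refl) (here refl) _    = ⇋ᶠ-allStars n
  blocks-antipodal (⇋-bit {c}) b∈          b′∈         b∥b′ = antipodal c b∈ b′∈ b∥b′

  fills-injective : ∀ {a a′ : Face m} {bs} → bs fills a → bs fills a′ → a ≡ a′
  fills-injective {a = []}    {[]}     []       []         = refl
  fills-injective {a = e ∷ _} {e′ ∷ _} (b∈ ∷ φ) (b∈′ ∷ φ′) =
    cong₂ _∷_ (blocks-injective e e′ b∈ b∈′) (fills-injective φ φ′)

  fills-parallel : ∀ {a a′ : Face m} {bs bs′} → bs fills a → bs′ fills a′ →
                   Pointwise _∥ᶠ_ bs bs′ → a ∥ᶠ a′
  fills-parallel {a = []}    {[]}     []       []         []         = []
  fills-parallel {a = e ∷ _} {e′ ∷ _} (b∈ ∷ φ) (b′∈ ∷ φ′) (b∥ ∷ ∥s) =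
    blocks-parallel e e′ b∈ b′∈ b∥ ∷ fills-parallel φ φ′ ∥s

  fills-parallel-free : ∀ {a : Face m} {bs bs′} → bs fills a → bs′ fills a →
                        Pointwise _∥ᶠ_ bs bs′ → bs ≡ bs′
  fills-parallel-free {a = []}    []       []         []         = refl
  fills-parallel-free {a = e ∷ _} (b∈ ∷ φ) (b′∈ ∷ φ′) (b∥ ∷ ∥s) =
    cong₂ _∷_ (blocks-parallel-free e b∈ b′∈ b∥) (fills-parallel-free φ φ′ ∥s)

  fills-antipodal : ∀ {a a′ : Face m} {bs bs′} → a ⇋ᶠ a′ → bs fills a → bs′ fills a′ →
                    Pointwise _∥ᶠ_ bs bs′ → Pointwise _⇋ᶠ_ bs bs′
  fills-antipodal []        []       []         []         = []
  fills-antipodal (e⇋ ∷ ⇋s) (b∈ ∷ φ) (b′∈ ∷ φ′) (b∥ ∷ ∥s) =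
    blocks-antipodal e⇋ b∈ b′∈ b∥ ∷ fills-antipodal ⇋s φ φ′ ∥s

  stars-concat : ∀ {a : Face m} {bs} → bs fills a → stars (concat bs) + codim a * suc k ≡ m * n
  stars-concat {a = []} [] = refl
  stars-concat {m = suc m} {a = star ∷ a} {_ ∷ bs} (here refl ∷ φ) = begin
    stars (allStars n ++ᵛ concat bs) + codim a * suc k
      ≡⟨ cong (_+ codim a * suc k) (stars-++ (allStars n) (concat bs)) ⟩
    stars (allStars n) + stars (concat bs) + codim a * suc k
      ≡⟨ +-assoc (stars (allStars n)) _ _ ⟩
    stars (allStars n) + (stars (concat bs) + codim a * suc k)
      ≡⟨ cong₂ _+_ (stars-allStars n) (stars-concat φ) ⟩
    n + m * n ∎
    where open ≡-Reasoning
  stars-concat {m = suc m} {a = bit c ∷ a} {b ∷ bs} (b∈ ∷ φ) = begin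
    stars (b ++ᵛ concat bs) + (suc k + codim a * suc k)
      ≡⟨ cong (_+ (suc k + codim a * suc k)) (stars-++ b (concat bs)) ⟩
    stars b + stars (concat bs) + (suc k + codim a * suc k)
      ≡⟨ interchange (stars b) _ (suc k) _ ⟩
    (stars b + suc k) + (stars (concat bs) + codim a * suc k)
      ≡⟨ cong₂ _+_ (dim c b∈) (stars-concat φ) ⟩
    n + m * n ∎
    where open ≡-Reasoning

  length-substitutions : ∀ (a : Face m) → length (substitutions a) ≡ (2 ^ k) ^ codim a
  length-substitutions []          = refl
  length-substitutions (star ∷ a)  =
    trans (length-cartesianProductWith _∷_ [ allStars n ] (substitutions a))
          (trans (*-identityˡ _) (length-substitutions a))
  length-substitutions (bit c ∷ a) =
    trans (length-cartesianProductWith _∷_ (half c) (substitutions a))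
          (cong₂ _*_ (card c) (length-substitutions a))

  Unique-substitutions : ∀ (a : Face m) → Unique (substitutions a)
  Unique-substitutions a = Unique-allChoices (VecAllₚ.map⁺ (VecAll.universal blocks-unique a))
    where
    blocks-unique : ∀ e → Unique (blocks e)
    blocks-unique star    = [] ∷ []
    blocks-unique (bit c) = distinct c

  colour : Point n → Bool
  colour r = proj₁ (cover r)

  covering-block : ∀ r {e} → colour r ∈ᵉ e → ∃ λ b → b ∈ blocks e × r ∈ᶠ b
  covering-block r ∈-star = allStars n , here refl , ∈ᶠ-allStars r
  covering-block r ∈-bit  = proj₂ (cover r)

  covering-substitution : ∀ (rows : Vec (Point n) m) {a} → vmap colour rows ∈ᶠ a →
                          ∃ λ bs → bs fills a × Pointwise _∈ᶠ_ rows bs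
  covering-substitution []         []              = [] , [] , []
  covering-substitution (r ∷ rows) (r∈e ∷ rows∈a)
    with b , b∈ , r∈b ← covering-block r r∈e
    with bs , φ , rows∈bs ← covering-substitution rows rows∈a
    = b ∷ bs , b∈ ∷ φ , r∈b ∷ rows∈bs

  substitute : ∀ {n₁ k₁} → AntipodalSplitting n₁ k₁ → AntipodalSplitting (n₁ * n) (k₁ * suc k)
  substitute {n₁} {k₁} S = record
    { faces     = faces′
    ; distinct  = Uniqueₚ.map⁺ concat-injective
                    (Unique-concatMap substitutions S₁.distinct Unique-substitutions
                       (λ bs∈ bs∈′ → fills-injective (∈-allChoices⁻ _ bs∈) (∈-allChoices⁻ _ bs∈′)))
    ; card      = card′
    ; dim       = dim′
    ; cover     = cover′
    ; antipodal = antipodal′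
    }
    where
    module S₁ = AntipodalSplitting S

    faces′ : List (Face (n₁ * n))
    faces′ = map concat (concatMap substitutions S₁.faces)

    ∈-faces′⁺ : ∀ {a bs} → a ∈ S₁.faces → bs fills a → concat bs ∈ faces′
    ∈-faces′⁺ a∈ φ = ∈-map⁺ concat (∈-concatMap⁺ substitutions (lose a∈ (∈-allChoices⁺ φ)))

    ∈-faces′⁻ : ∀ {F} → F ∈ faces′ → ∃₂ λ a bs → a ∈ S₁.faces × bs fills a × F ≡ concat bs
    ∈-faces′⁻ F∈
      with bs , bs∈ , refl ← ∈-map⁻ concat F∈
      with a , a∈ , bs∈a ← find (∈-concatMap⁻ substitutions bs∈)
      = a , bs , a∈ , ∈-allChoices⁻ _ bs∈a , refl

    codim≡k₁ : ∀ {a} → a ∈ S₁.faces → codim a ≡ k₁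
    codim≡k₁ {a} a∈ = +-cancelˡ-≡ (stars a) _ _ (trans (stars+codim a) (sym (S₁.dim a a∈)))

    card′ : length faces′ ≡ 2 ^ (k₁ * suc k)
    card′ = begin
      length faces′                              ≡⟨ length-map concat (concatMap substitutions S₁.faces) ⟩
      length (concatMap substitutions S₁.faces)  ≡⟨ length-concatMap substitutions S₁.faces
                                                      (All.tabulate length-substitutions-k₁) ⟩
      length S₁.faces * (2 ^ k) ^ k₁             ≡⟨ cong (_* (2 ^ k) ^ k₁) S₁.card ⟩
      2 ^ k₁ * (2 ^ k) ^ k₁                      ≡⟨ cong (2 ^ k₁ *_) (^-*-assoc 2 k k₁) ⟩
      2 ^ k₁ * 2 ^ (k * k₁)                      ≡⟨ ^-distribˡ-+-* 2 k₁ (k * k₁) ⟨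
      2 ^ (suc k * k₁)                           ≡⟨ cong (2 ^_) (*-comm (suc k) k₁) ⟩
      2 ^ (k₁ * suc k)                           ∎
      where
      open ≡-Reasoning
      length-substitutions-k₁ : ∀ {a} → a ∈ S₁.faces → length (substitutions a) ≡ (2 ^ k) ^ k₁
      length-substitutions-k₁ {a} a∈ = trans (length-substitutions a) (cong ((2 ^ k) ^_) (codim≡k₁ a∈))

    dim′ : ∀ F → F ∈ faces′ → stars F + k₁ * suc k ≡ n₁ * n
    dim′ _ F∈ with a , bs , a∈ , φ , refl ← ∈-faces′⁻ F∈ =
      subst (λ c → stars (concat bs) + c * suc k ≡ n₁ * n) (codim≡k₁ a∈) (stars-concat φ)

    cover′ : ∀ X → ∃ λ F → F ∈ faces′ × X ∈F F
    cover′ X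
      with rows , refl ← group n₁ n X
      with a , a∈ , colours∈a ← coverᶠ S (vmap colour rows)
      with bs , φ , rows∈bs ← covering-substitution rows colours∈a
      = concat bs , ∈-faces′⁺ a∈ φ , Equivalence.to ∈ᶠ⇔∈F (Pointwise.concat⁺ rows∈bs)

    substitution-antipodal : ∀ {a a′ bs bs′} → a ∈ S₁.faces → a′ ∈ S₁.faces →
                             bs fills a → bs′ fills a′ → concat bs ≢ concat bs′ →
                             Pointwise _∥ᶠ_ bs bs′ → Pointwise _⇋ᶠ_ bs bs′
    substitution-antipodal {a} {a′} a∈ a′∈ φ φ′ F≢G ∥s with a ≟ᶠ a′
    ... | yes refl = ⊥-elim (F≢G (cong concat (fills-parallel-free φ φ′ ∥s)))
    ... | no  a≢a′ = fills-antipodal (antipodalᶠ S a∈ a′∈ a≢a′ (fills-parallel φ φ′ ∥s)) φ φ′ ∥s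

    antipodal′ : ∀ F G → F ∈ faces′ → G ∈ faces′ → F ≢ G → Parallel F G → Antipodal F G
    antipodal′ _ _ F∈ G∈ F≢G F∥G
      with a , bs , a∈ , φ , refl ← ∈-faces′⁻ F∈
      with a′ , bs′ , a′∈ , φ′ , refl ← ∈-faces′⁻ G∈
      = Equivalence.to ⇋ᶠ⇔Antipodal (Pointwise.concat⁺ (substitution-antipodal a∈ a′∈ φ φ′ F≢G
          (Pointwise.concat⁻ bs bs′ (Equivalence.from ∥ᶠ⇔Parallel F∥G))))

open Substitution using (substitute)

proposition2 : ∀ (n₁ k₁ n₂ k₂ : ℕ) → AntipodalSplitting n₁ k₁ → AntipodalSplitting n₂ k₂ → AntipodalSplitting (n₁ * n₂) (k₁ * k₂)
proposition2 n₁ k₁ n₂ zero    S₁ S₂ =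
  subst (AntipodalSplitting (n₁ * n₂)) (sym (*-zeroʳ k₁)) (wholeCube (n₁ * n₂))
proposition2 n₁ k₁ n₂ (suc k) S₁ S₂ = substitute (halve S₂) S₁
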